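{- There is a universal constant $C>0$ such that the following holds. Let $D$ be a finite set and let $T=(T_{p0},T_{p1},T_{q0},T_{q1})$ be four fixed finite multisets of elements of $D$. Independently and uniformly at random, assign each element of each $T_{\cdot}$ to one of two parts $S_{\cdot}$ or $S'_{\cdot}$. Let $M$ be the number of elements of $T_{p0}\cup T_{p1}\cup T_{q0}\cup T_{q1}$ whose value appears at least twice in this union, and let $N$ be the number of elements of $S=S_{p0}\cup S_{p1}\cup S_{q0}\cup S_{q1}$ whose value appears at least twice in $S$. Then for every $\delta\in(0,1)$, $$\mathbf{Pr}\big[M>C(N+\log(1/\delta))\big]\le\delta.$$
   Context: The probability is over the random assignment only, with $T$ fixed.
   Formalization: The parameter δ ranges over the rationals in (0,1). -}

module Defs where

open import Data.Nat using (ℕ; zero; suc; _≤?_; _^_; _*_)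
open import Data.Bool using (Bool; true; false)
open import Data.Fin using (Fin)
open import Data.Fin.Properties using (_≟_)
open import Data.List using (List; []; _∷_; length; filter; map; _++_)
open import Data.Vec using (Vec; []; _∷_)
open import Data.Integer using (+_)
open import Data.Rational using (ℚ; 1ℚ; _/_; _<_) renaming (_*_ to _*ℚ_)
open import Data.Rational.Properties using (_<?_)

occ : ∀ {d} → Fin d → List (Fin d) → ℕ
occ x L = length (filter (λ y → x ≟ y) L)

repeated : ∀ {d} → List (Fin d) → ℕ
repeated L = length (filter (λ x → 2 ≤? occ x L) L)

-- all 2^n assignments of n elements to the two parts (true = S, false = S')
assignments : (n : ℕ) → List (Vec Bool n)
assignments zero = [] ∷ []
assignments (suc n) =
  map (true ∷_) (assignments n) ++ map (false ∷_) (assignments n)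

selectS : ∀ {d} → (L : List (Fin d)) → Vec Bool (length L) → List (Fin d)
selectS [] [] = []
selectS (x ∷ L) (true ∷ a) = x ∷ selectS L a
selectS (x ∷ L) (false ∷ a) = selectS L a

powℚ : ℚ → ℕ → ℚ
powℚ q zero = 1ℚ
powℚ q (suc n) = q *ℚ powℚ q n

ℕtoℚ : ℕ → ℚ
ℕtoℚ n = + n / 1

-- the bad event  M > C (N + log₂(1/δ)),  written equivalently (all quantities
-- positive) as  δ^C · 2^M > 2^(C·N)
Bad : ℕ → ℚ → ℕ → ℕ → Set
Bad C δ M N = ℕtoℚ (2 ^ (C * N)) < powℚ δ C *ℚ ℕtoℚ (2 ^ M)

badCount : ∀ {d} → ℕ → ℚ → (T : List (Fin d)) → ℕ
badCount C δ T =
  length (filter (λ a → ℕtoℚ (2 ^ (C * repeated (selectS T a)))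
                          <? powℚ δ C *ℚ ℕtoℚ (2 ^ repeated T))
                 (assignments (length T)))

module Submission where

-- Markov's inequality for 2^(−N). Reading T from left to right, call a selected element a repeat
-- when its value has already been selected; N is at least the number r of repeats. Once a value
-- has been selected, each later copy of it is a repeat with probability 1/2, and a potential
-- argument turns this into E[2^(−r)] ≤ (15/16)^h, where h is the number of elements of T whose
-- value recurs later in T, so that M ≤ 2h. Since (16/15)^22 ≥ 4, the event
-- M > 22 (N + log₂(1/δ)) forces 2^(−N) > (15/16)^h / δ, which has probability at most δ.

open import Defs

module Combinatorics where
  open import Data.Bool using (Bool; true; false; _∨_; if_then_else_)
  open import Data.Empty using (⊥-elim)
  open import Data.Fin using (Fin)
  open import Data.Fin.Properties using (_≟_)
  open import Data.List using (List; []; _∷_; _++_; length; filter; map)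
  open import Data.List.Properties using (map-++; map-∘)
  open import Data.Nat
    using (ℕ; zero; suc; _+_; _*_; _^_; _≤_; _<_; _≤′_; ≤′-refl; ≤′-step; _≤?_; z≤n; s≤s)
  import Data.Nat.Properties as ℕP
  open import Data.Nat.ListAction using (sum)
  open import Data.Nat.ListAction.Properties using (sum-++)
  open import Data.Nat.Tactic.RingSolver using (solve-∀)
  open import Data.Vec using (Vec; []; _∷_)
  open import Function using (_∘_; flip)
  open import Relation.Binary.PropositionalEquality
  open import Relation.Nullary using (does; yes; no)
  open import Relation.Nullary.Decidable using (dec-true; dec-false)

  private variable
    d : ℕ

  𝟙 : Bool → ℕ
  𝟙 true = 1
  𝟙 false = 0

  𝟙≤1 : ∀ b → 𝟙 b ≤ 1
  𝟙≤1 true = ℕP.≤-refl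
  𝟙≤1 false = z≤n

  sum-map-*ˡ : ∀ {A : Set} c (f : A → ℕ) L → sum (map (λ a → c * f a) L) ≡ c * sum (map f L)
  sum-map-*ˡ c f [] = sym (ℕP.*-zeroʳ c)
  sum-map-*ˡ c f (x ∷ L) rewrite sum-map-*ˡ c f L = sym (ℕP.*-distribˡ-+ c (f x) (sum (map f L)))

  infix 6 _∈ᵇ_
  _∈ᵇ_ : Fin d → List (Fin d) → Bool
  x ∈ᵇ [] = false
  x ∈ᵇ (y ∷ L) = does (x ≟ y) ∨ x ∈ᵇ L

  ∈ᵇ-self : ∀ (x : Fin d) L → x ∈ᵇ (x ∷ L) ≡ true
  ∈ᵇ-self x L rewrite dec-true (x ≟ x) refl = refl

  occ-∷ : ∀ (x y : Fin d) L → occ x (y ∷ L) ≡ 𝟙 (does (x ≟ y)) + occ x L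
  occ-∷ x y L with does (x ≟ y)
  ... | true = refl
  ... | false = refl

  occ-self : ∀ (x : Fin d) L → occ x (x ∷ L) ≡ suc (occ x L)
  occ-self x L rewrite occ-∷ x x L | dec-true (x ≟ x) refl = refl

  occ-∷-≢ : ∀ {x y : Fin d} L → x ≢ y → occ x (y ∷ L) ≡ occ x L
  occ-∷-≢ {x = x} {y} L x≢y rewrite occ-∷ x y L | dec-false (x ≟ y) x≢y = refl

  occ-++ : ∀ (x : Fin d) A B → occ x (A ++ B) ≡ occ x A + occ x B
  occ-++ x [] B = refl
  occ-++ x (y ∷ A) B rewrite occ-∷ x y (A ++ B) | occ-∷ x y A | occ-++ x A B =
    sym (ℕP.+-assoc (𝟙 (does (x ≟ y))) (occ x A) (occ x B))

  occ-++-∷ : ∀ (x y : Fin d) P S → occ y (P ++ x ∷ S) ≡ occ y (x ∷ P ++ S)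
  occ-++-∷ x y P S rewrite occ-∷ y x (P ++ S) | occ-++ y P S | occ-++ y P (x ∷ S) | occ-∷ y x S =
    swap (𝟙 (does (y ≟ x))) (occ y P) (occ y S)
    where
    swap : ∀ a b c → b + (a + c) ≡ a + (b + c)
    swap = solve-∀

  ∈ᵇ⇒occ>0 : ∀ (x : Fin d) L → x ∈ᵇ L ≡ true → 0 < occ x L
  ∈ᵇ⇒occ>0 x (y ∷ L) x∈L rewrite occ-∷ x y L with does (x ≟ y)
  ... | true = s≤s z≤n
  ... | false = ∈ᵇ⇒occ>0 x L x∈L

  ∉ᵇ⇒occ≡0 : ∀ (x : Fin d) L → x ∈ᵇ L ≡ false → occ x L ≡ 0
  ∉ᵇ⇒occ≡0 x [] _ = refl
  ∉ᵇ⇒occ≡0 x (y ∷ L) x∉L rewrite occ-∷ x y L with does (x ≟ y) | x∉L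
  ... | false | x∉L′ = ∉ᵇ⇒occ≡0 x L x∉L′

  2≤occ-++-∷ : ∀ (x : Fin d) P S → x ∈ᵇ P ≡ true → 2 ≤ occ x (P ++ x ∷ S)
  2≤occ-++-∷ x P S x∈P rewrite occ-++ x P (x ∷ S) | occ-self x S =
    ℕP.+-mono-≤ (∈ᵇ⇒occ>0 x P x∈P) (s≤s z≤n)

  repeatedBy : (Fin d → ℕ) → List (Fin d) → ℕ
  repeatedBy m [] = 0
  repeatedBy m (y ∷ S) = 𝟙 (does (2 ≤? m y)) + repeatedBy m S

  length-filter≡repeatedBy : ∀ (m : Fin d → ℕ) S → length (filter (λ y → 2 ≤? m y) S) ≡ repeatedBy m S
  length-filter≡repeatedBy m [] = refl
  length-filter≡repeatedBy m (y ∷ S) with does (2 ≤? m y)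
  ... | true = cong suc (length-filter≡repeatedBy m S)
  ... | false = length-filter≡repeatedBy m S

  repeatedBy-cong : ∀ (m m′ : Fin d → ℕ) S → (∀ y → does (2 ≤? m y) ≡ does (2 ≤? m′ y)) →
                    repeatedBy m S ≡ repeatedBy m′ S
  repeatedBy-cong m m′ [] _ = refl
  repeatedBy-cong m m′ (y ∷ S) eq = cong₂ _+_ (cong 𝟙 (eq y)) (repeatedBy-cong m m′ S eq)

  repeatedBy-≤+occ : ∀ (m m′ : Fin d → ℕ) x S → (∀ y → y ≢ x → m′ y ≡ m y) →
                     repeatedBy m′ S ≤ repeatedBy m S + occ x S
  repeatedBy-≤+occ m m′ x [] _ = z≤n
  repeatedBy-≤+occ m m′ x (y ∷ S) agree rewrite occ-∷ x y S with x ≟ y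
  ... | yes refl =
    ℕP.≤-trans (ℕP.+-mono-≤ (𝟙≤1 _) ih) (absorb (𝟙 (does (2 ≤? m x))) (repeatedBy m S) (occ x S))
    where
    ih = repeatedBy-≤+occ m m′ x S agree
    absorb : ∀ a r o → 1 + (r + o) ≤ (a + r) + (1 + o)
    absorb a r o = ℕP.≤-trans (ℕP.m≤n+m _ a) (ℕP.≤-reflexive (shuffle a r o))
      where
      shuffle : ∀ a r o → a + (1 + (r + o)) ≡ (a + r) + (1 + o)
      shuffle = solve-∀
  ... | no x≢y rewrite agree y (x≢y ∘ sym) =
    ℕP.≤-trans (ℕP.+-monoʳ-≤ b (repeatedBy-≤+occ m m′ x S agree)) (ℕP.≤-reflexive (sym (ℕP.+-assoc b _ _)))
    where b = 𝟙 (does (2 ≤? m y))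

  does-2≤?-suc : ∀ k → k ≢ 1 → does (2 ≤? suc k) ≡ does (2 ≤? k)
  does-2≤?-suc zero _ = refl
  does-2≤?-suc (suc zero) k≢1 = ⊥-elim (k≢1 refl)
  does-2≤?-suc (suc (suc k)) _ = refl

  2≤occ-∷-agree : ∀ (x : Fin d) T → occ x T ≢ 1 → ∀ y → does (2 ≤? occ y (x ∷ T)) ≡ does (2 ≤? occ y T)
  2≤occ-∷-agree x T occ≢1 y with y ≟ x
  ... | yes refl = does-2≤?-suc (occ y T) occ≢1
  ... | no _ = refl

  -- Prepending x creates at most two new repeated elements (x itself and its unique later copy),
  -- and only if x occurs in T.
  repeatedBy-occ-∷ : ∀ (x : Fin d) T →
    𝟙 (does (2 ≤? suc (occ x T))) + repeatedBy (flip occ (x ∷ T)) T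
      ≤ 2 * 𝟙 (x ∈ᵇ T) + repeatedBy (flip occ T) T
  repeatedBy-occ-∷ x T with x ∈ᵇ T in x∈T | occ x T in occ≡
  ... | false | zero =
    ℕP.≤-reflexive (repeatedBy-cong (flip occ (x ∷ T)) (flip occ T) T (2≤occ-∷-agree x T occ≢1))
    where
    occ≢1 : occ x T ≢ 1
    occ≢1 e = ℕP.0≢1+n (trans (sym occ≡) e)
  ... | false | suc k = ⊥-elim (ℕP.0≢1+n (trans (sym (∉ᵇ⇒occ≡0 x T x∈T)) occ≡))
  ... | true | zero = ⊥-elim (ℕP.n≮0 (subst (0 <_) occ≡ (∈ᵇ⇒occ>0 x T x∈T)))
  ... | true | suc zero =
    s≤s (ℕP.≤-trans (repeatedBy-≤+occ (flip occ T) (flip occ (x ∷ T)) x T (λ y → occ-∷-≢ T))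
                    (ℕP.≤-reflexive (trans (cong (_ +_) occ≡) (ℕP.+-comm _ 1))))
  ... | true | suc (suc k) =
    s≤s (ℕP.≤-trans
      (ℕP.≤-reflexive (repeatedBy-cong (flip occ (x ∷ T)) (flip occ T) T (2≤occ-∷-agree x T occ≢1)))
      (ℕP.n≤1+n _))
    where
    occ≢1 : occ x T ≢ 1
    occ≢1 e = ℕP.1+n≢0 (ℕP.suc-injective (trans (sym occ≡) e))

  repeated-∷ : ∀ (x : Fin d) T → repeated (x ∷ T) ≤ 2 * 𝟙 (x ∈ᵇ T) + repeated T
  repeated-∷ x T = begin
    repeated (x ∷ T)
      ≡⟨ length-filter≡repeatedBy (flip occ (x ∷ T)) (x ∷ T) ⟩
    𝟙 (does (2 ≤? occ x (x ∷ T))) + repeatedBy (flip occ (x ∷ T)) T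
      ≡⟨ cong (λ k → 𝟙 (does (2 ≤? k)) + repeatedBy (flip occ (x ∷ T)) T) (occ-self x T) ⟩
    𝟙 (does (2 ≤? suc (occ x T))) + repeatedBy (flip occ (x ∷ T)) T
      ≤⟨ repeatedBy-occ-∷ x T ⟩
    2 * 𝟙 (x ∈ᵇ T) + repeatedBy (flip occ T) T
      ≡⟨ cong (2 * 𝟙 (x ∈ᵇ T) +_) (length-filter≡repeatedBy (flip occ T) T) ⟨
    2 * 𝟙 (x ∈ᵇ T) + repeated T ∎
    where open ℕP.≤-Reasoning

  -- The potential of T given the set Q of values already selected. An element whose value is in Q
  -- weighs 3: it is a repeat with probability 1/2, which scales E[2^(−r)] by 3/4 ≤ (15/16)³.
  positionWeight : Fin d → List (Fin d) → List (Fin d) → ℕ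
  positionWeight y Q T = if y ∈ᵇ Q then 3 else 𝟙 (y ∈ᵇ T)

  weight : List (Fin d) → List (Fin d) → ℕ
  weight [] Q = 0
  weight (y ∷ T) Q = positionWeight y Q T + weight T Q

  repeated≤2*weight : ∀ (T : List (Fin d)) → repeated T ≤ 2 * weight T []
  repeated≤2*weight [] = z≤n
  repeated≤2*weight (x ∷ T) = begin
    repeated (x ∷ T)                   ≤⟨ repeated-∷ x T ⟩
    2 * 𝟙 (x ∈ᵇ T) + repeated T         ≤⟨ ℕP.+-monoʳ-≤ _ (repeated≤2*weight T) ⟩
    2 * 𝟙 (x ∈ᵇ T) + 2 * weight T []    ≡⟨ ℕP.*-distribˡ-+ 2 (𝟙 (x ∈ᵇ T)) (weight T []) ⟨
    2 * weight (x ∷ T) []               ∎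
    where open ℕP.≤-Reasoning

  positionWeight≤3 : ∀ (y : Fin d) Q T → positionWeight y Q T ≤ 3
  positionWeight≤3 y Q T with y ∈ᵇ Q
  ... | true = ℕP.≤-refl
  ... | false = ℕP.≤-trans (𝟙≤1 (y ∈ᵇ T)) (s≤s z≤n)

  positionWeight-mono : ∀ (x y : Fin d) Q T → positionWeight y Q T ≤ positionWeight y (x ∷ Q) T
  positionWeight-mono x y Q T with y ∈ᵇ (x ∷ Q) in y∈xQ
  ... | true = positionWeight≤3 y Q T
  ... | false with does (y ≟ x) | y ∈ᵇ Q in y∈Q | y∈xQ
  ...   | false | false | _ = ℕP.≤-refl

  weight-mono : ∀ (x : Fin d) T Q → weight T Q ≤ weight T (x ∷ Q)
  weight-mono x [] Q = z≤n
  weight-mono x (y ∷ T) Q = ℕP.+-mono-≤ (positionWeight-mono x y Q T) (weight-mono x T Q)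

  weight-gain : ∀ (x : Fin d) T Q → x ∈ᵇ Q ≡ false → 3 * 𝟙 (x ∈ᵇ T) + weight T Q ≤ weight T (x ∷ Q)
  weight-gain x [] Q x∉Q = z≤n
  weight-gain x (y ∷ T) Q x∉Q with x ≟ y
  ... | yes refl rewrite ∈ᵇ-self x Q | x∉Q =
    ℕP.+-monoʳ-≤ 3 (ℕP.≤-trans (ℕP.+-monoˡ-≤ (weight T Q) (ℕP.m≤n*m (𝟙 (x ∈ᵇ T)) 3))
                               (weight-gain x T Q x∉Q))
  ... | no _ = begin
    3 * 𝟙 (x ∈ᵇ T) + (positionWeight y Q T + weight T Q)
      ≡⟨ swap (3 * 𝟙 (x ∈ᵇ T)) (positionWeight y Q T) (weight T Q) ⟩
    positionWeight y Q T + (3 * 𝟙 (x ∈ᵇ T) + weight T Q)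
      ≤⟨ ℕP.+-mono-≤ (positionWeight-mono x y Q T) (weight-gain x T Q x∉Q) ⟩
    positionWeight y (x ∷ Q) T + weight T (x ∷ Q)
      ∎
    where
    open ℕP.≤-Reasoning
    swap : ∀ a b c → a + (b + c) ≡ b + (a + c)
    swap = solve-∀

  -- 2^(length T − r), where r counts the selected elements whose value is in Q or was selected
  -- earlier.
  freshWeight : (T : List (Fin d)) → List (Fin d) → Vec Bool (length T) → ℕ
  freshWeight [] Q [] = 1
  freshWeight (x ∷ T) Q (true ∷ a) = (if x ∈ᵇ Q then 1 else 2) * freshWeight T (x ∷ Q) a
  freshWeight (x ∷ T) Q (false ∷ a) = 2 * freshWeight T Q a

  2^suc≤factor*G*2^[b+c] : ∀ n G b c β → (β ≡ true → 1 ≤ b) → 2 ^ n ≤ G * 2 ^ c →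
                           2 ^ suc n ≤ (if β then 1 else 2) * G * 2 ^ (b + c)
  2^suc≤factor*G*2^[b+c] n G b c true 1≤b le = begin
    2 * 2 ^ n            ≤⟨ ℕP.*-monoʳ-≤ 2 le ⟩
    2 * (G * 2 ^ c)      ≡⟨ rearrange G (2 ^ c) ⟩
    1 * G * 2 ^ (1 + c)  ≤⟨ ℕP.*-monoʳ-≤ (1 * G) (ℕP.^-monoʳ-≤ 2 (ℕP.+-monoˡ-≤ c (1≤b refl))) ⟩
    1 * G * 2 ^ (b + c)  ∎
    where
    open ℕP.≤-Reasoning
    rearrange : ∀ G x → 2 * (G * x) ≡ 1 * G * (2 * x)
    rearrange = solve-∀
  2^suc≤factor*G*2^[b+c] n G b c false _ le = begin
    2 * 2 ^ n            ≤⟨ ℕP.*-monoʳ-≤ 2 le ⟩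
    2 * (G * 2 ^ c)      ≡⟨ ℕP.*-assoc 2 G _ ⟨
    2 * G * 2 ^ c        ≤⟨ ℕP.*-monoʳ-≤ (2 * G) (ℕP.^-monoʳ-≤ 2 (ℕP.m≤n+m c b)) ⟩
    2 * G * 2 ^ (b + c)  ∎
    where open ℕP.≤-Reasoning

  1≤𝟙-2≤? : ∀ {k} → 2 ≤ k → 1 ≤ 𝟙 (does (2 ≤? k))
  1≤𝟙-2≤? (s≤s (s≤s _)) = s≤s z≤n

  2^length≤freshWeight*2^repeatedBy : ∀ (T Q : List (Fin d)) a →
    2 ^ length T ≤ freshWeight T Q a * 2 ^ repeatedBy (flip occ (Q ++ selectS T a)) (selectS T a)
  2^length≤freshWeight*2^repeatedBy [] Q [] = ℕP.≤-refl
  2^length≤freshWeight*2^repeatedBy (x ∷ T) Q (false ∷ a) =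
    2^suc≤factor*G*2^[b+c] (length T) (freshWeight T Q a) 0 (repeatedBy (flip occ (Q ++ S)) S)
      false (λ ()) (2^length≤freshWeight*2^repeatedBy T Q a)
    where S = selectS T a
  2^length≤freshWeight*2^repeatedBy (x ∷ T) Q (true ∷ a) =
    2^suc≤factor*G*2^[b+c] (length T) (freshWeight T (x ∷ Q) a) (𝟙 (does (2 ≤? occ x (Q ++ x ∷ S)))) c
      (x ∈ᵇ Q) (λ x∈Q → 1≤𝟙-2≤? (2≤occ-++-∷ x Q S x∈Q)) ih
    where
    S = selectS T a
    c = repeatedBy (flip occ (Q ++ x ∷ S)) S
    ih : 2 ^ length T ≤ freshWeight T (x ∷ Q) a * 2 ^ c
    ih = subst (λ c → 2 ^ length T ≤ freshWeight T (x ∷ Q) a * 2 ^ c)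
           (repeatedBy-cong (flip occ (x ∷ Q ++ S)) (flip occ (Q ++ x ∷ S)) S
              (λ y → cong (λ k → does (2 ≤? k)) (sym (occ-++-∷ x y Q S))))
           (2^length≤freshWeight*2^repeatedBy T (x ∷ Q) a)

  totalFreshWeight : List (Fin d) → List (Fin d) → ℕ
  totalFreshWeight T Q = sum (map (freshWeight T Q) (assignments (length T)))

  totalFreshWeight-∷ : ∀ (x : Fin d) T Q →
    totalFreshWeight (x ∷ T) Q ≡ (if x ∈ᵇ Q then 1 else 2) * totalFreshWeight T (x ∷ Q) + 2 * totalFreshWeight T Q
  totalFreshWeight-∷ x T Q = begin
    sum (map g (map (true ∷_) A ++ map (false ∷_) A))
      ≡⟨ cong sum (map-++ g (map (true ∷_) A) (map (false ∷_) A)) ⟩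
    sum (map g (map (true ∷_) A) ++ map g (map (false ∷_) A))
      ≡⟨ sum-++ (map g (map (true ∷_) A)) (map g (map (false ∷_) A)) ⟩
    sum (map g (map (true ∷_) A)) + sum (map g (map (false ∷_) A))
      ≡⟨ cong₂ _+_ (trans (cong sum (sym (map-∘ A))) (sum-map-*ˡ β (freshWeight T (x ∷ Q)) A))
                   (trans (cong sum (sym (map-∘ A))) (sum-map-*ˡ 2 (freshWeight T Q) A)) ⟩
    (if x ∈ᵇ Q then 1 else 2) * totalFreshWeight T (x ∷ Q) + 2 * totalFreshWeight T Q ∎
    where
    open ≡-Reasoning
    g = freshWeight (x ∷ T) Q
    A = assignments (length T)
    β = if x ∈ᵇ Q then 1 else 2

  -- G ≤ X · (15/16)^k, with the denominators cleared
  infix 4 _≼⟨_⟩_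
  _≼⟨_⟩_ : ℕ → ℕ → ℕ → Set
  G ≼⟨ k ⟩ X = G * 16 ^ k ≤ X * 15 ^ k

  ≼-pred : ∀ G X k → G ≼⟨ suc k ⟩ X → G ≼⟨ k ⟩ X
  ≼-pred G X k le = ℕP.*-cancelʳ-≤ (G * 16 ^ k) (X * 15 ^ k) 16 (begin
    G * 16 ^ k * 16    ≡⟨ shift G (16 ^ k) ⟩
    G * (16 * 16 ^ k)  ≤⟨ le ⟩
    X * (15 * 15 ^ k)  ≡⟨ shift X (15 ^ k) ⟨
    X * 15 ^ k * 15    ≤⟨ ℕP.*-monoʳ-≤ (X * 15 ^ k) (ℕP.n≤1+n 15) ⟩
    X * 15 ^ k * 16    ∎)
    where
    open ℕP.≤-Reasoning
    shift : ∀ {c} a b → a * b * c ≡ a * (c * b)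
    shift {c} a b = trans (ℕP.*-assoc a b c) (cong (a *_) (ℕP.*-comm b c))

  ≼-weaken : ∀ G X {j k} → j ≤ k → G ≼⟨ k ⟩ X → G ≼⟨ j ⟩ X
  ≼-weaken G X {j} j≤k = go (ℕP.≤⇒≤′ j≤k)
    where
    go : ∀ {k} → j ≤′ k → G ≼⟨ k ⟩ X → G ≼⟨ j ⟩ X
    go ≤′-refl le = le
    go (≤′-step {k} j≤′k) le = go j≤′k (≼-pred G X k le)

  -- The three cases of the potential step rest on 1 + 2 ≤ 4·(15/16)³, 2·(15/16)³ + 2 ≤ 4·(15/16)
  -- and 2 + 2 ≤ 4.
  ≼-split-3 : ∀ G₁ G₂ X k → G₁ ≼⟨ k ⟩ X → G₂ ≼⟨ k ⟩ X → 1 * G₁ + 2 * G₂ ≼⟨ 3 + k ⟩ 4 * X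
  ≼-split-3 G₁ G₂ X k le₁ le₂ = begin
    (1 * G₁ + 2 * G₂) * (16 * (16 * (16 * u)))  ≡⟨ expand G₁ G₂ u ⟩
    4096 * (G₁ * u) + 8192 * (G₂ * u)           ≤⟨ ℕP.+-mono-≤ (ℕP.*-monoʳ-≤ 4096 le₁)
                                                                (ℕP.*-monoʳ-≤ 8192 le₂) ⟩
    4096 * (X * v) + 8192 * (X * v)             ≡⟨ collect (X * v) ⟩
    12288 * (X * v)                             ≤⟨ ℕP.*-monoˡ-≤ (X * v) (ℕP.m≤m+n 12288 1212) ⟩
    13500 * (X * v)                             ≡⟨ factor X v ⟩
    4 * X * (15 * (15 * (15 * v)))              ∎
    where
    open ℕP.≤-Reasoning
    u = 16 ^ k
    v = 15 ^ k
    expand : ∀ a b u → (1 * a + 2 * b) * (16 * (16 * (16 * u))) ≡ 4096 * (a * u) + 8192 * (b * u)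
    expand = solve-∀
    collect : ∀ w → 4096 * w + 8192 * w ≡ 12288 * w
    collect = solve-∀
    factor : ∀ X v → 13500 * (X * v) ≡ 4 * X * (15 * (15 * (15 * v)))
    factor = solve-∀

  ≼-split-1 : ∀ G₁ G₂ X k → G₁ ≼⟨ 3 + k ⟩ X → G₂ ≼⟨ k ⟩ X → 2 * G₁ + 2 * G₂ ≼⟨ 1 + k ⟩ 4 * X
  ≼-split-1 G₁ G₂ X k le₁ le₂ = ℕP.*-cancelʳ-≤ _ _ 256 (begin
    (2 * G₁ + 2 * G₂) * (16 * u) * 256                    ≡⟨ expand G₁ G₂ u ⟩
    2 * (G₁ * (16 * (16 * (16 * u)))) + 8192 * (G₂ * u)   ≤⟨ ℕP.+-mono-≤ (ℕP.*-monoʳ-≤ 2 le₁)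
                                                                          (ℕP.*-monoʳ-≤ 8192 le₂) ⟩
    2 * (X * (15 * (15 * (15 * v)))) + 8192 * (X * v)     ≡⟨ collect X v ⟩
    14942 * (X * v)                                       ≤⟨ ℕP.*-monoˡ-≤ (X * v) (ℕP.m≤m+n 14942 418) ⟩
    15360 * (X * v)                                       ≡⟨ factor X v ⟩
    4 * X * (15 * v) * 256                                ∎)
    where
    open ℕP.≤-Reasoning
    u = 16 ^ k
    v = 15 ^ k
    expand : ∀ a b u → (2 * a + 2 * b) * (16 * u) * 256 ≡ 2 * (a * (16 * (16 * (16 * u)))) + 8192 * (b * u)
    expand = solve-∀
    collect : ∀ X v → 2 * (X * (15 * (15 * (15 * v)))) + 8192 * (X * v) ≡ 14942 * (X * v)
    collect = solve-∀
    factor : ∀ X v → 15360 * (X * v) ≡ 4 * X * (15 * v) * 256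
    factor = solve-∀

  ≼-split-0 : ∀ G₁ G₂ X k → G₁ ≼⟨ k ⟩ X → G₂ ≼⟨ k ⟩ X → 2 * G₁ + 2 * G₂ ≼⟨ k ⟩ 4 * X
  ≼-split-0 G₁ G₂ X k le₁ le₂ = begin
    (2 * G₁ + 2 * G₂) * u          ≡⟨ expand G₁ G₂ u ⟩
    2 * (G₁ * u) + 2 * (G₂ * u)    ≤⟨ ℕP.+-mono-≤ (ℕP.*-monoʳ-≤ 2 le₁) (ℕP.*-monoʳ-≤ 2 le₂) ⟩
    2 * (X * v) + 2 * (X * v)      ≡⟨ factor X v ⟩
    4 * X * v                      ∎
    where
    open ℕP.≤-Reasoning
    u = 16 ^ k
    v = 15 ^ k
    expand : ∀ a b u → (2 * a + 2 * b) * u ≡ 2 * (a * u) + 2 * (b * u)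
    expand = solve-∀
    factor : ∀ X v → 2 * (X * v) + 2 * (X * v) ≡ 4 * X * v
    factor = solve-∀

  ≼-∷ : ∀ G₁ G₂ X (x : Fin d) T Q → G₁ ≼⟨ weight T (x ∷ Q) ⟩ X → G₂ ≼⟨ weight T Q ⟩ X →
        (if x ∈ᵇ Q then 1 else 2) * G₁ + 2 * G₂ ≼⟨ weight (x ∷ T) Q ⟩ 4 * X
  ≼-∷ G₁ G₂ X x T Q le₁ le₂ with x ∈ᵇ Q in x∈Q
  ... | true = ≼-split-3 G₁ G₂ X (weight T Q) (≼-weaken G₁ X (weight-mono x T Q) le₁) le₂
  ... | false with x ∈ᵇ T in x∈T
  ...   | true = ≼-split-1 G₁ G₂ X (weight T Q) (≼-weaken G₁ X gain le₁) le₂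
    where
    gain : 3 + weight T Q ≤ weight T (x ∷ Q)
    gain = subst (λ b → 3 * 𝟙 b + weight T Q ≤ weight T (x ∷ Q)) x∈T (weight-gain x T Q x∈Q)
  ...   | false = ≼-split-0 G₁ G₂ X (weight T Q) (≼-weaken G₁ X (weight-mono x T Q) le₁) le₂

  totalFreshWeight≼ : ∀ (T Q : List (Fin d)) → totalFreshWeight T Q ≼⟨ weight T Q ⟩ 4 ^ length T
  totalFreshWeight≼ [] Q = ℕP.≤-refl
  totalFreshWeight≼ (x ∷ T) Q rewrite totalFreshWeight-∷ x T Q =
    ≼-∷ (totalFreshWeight T (x ∷ Q)) (totalFreshWeight T Q) (4 ^ length T) x T Q
      (totalFreshWeight≼ T (x ∷ Q)) (totalFreshWeight≼ T Q)

open Combinatorics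
open import Algebra.Bundles using (CommutativeMonoid)
import Algebra.Properties.CommutativeSemigroup as CommSemigroupProperties
open import Data.Fin using (Fin)
open import Data.Integer as ℤ using (+_)
import Data.Integer.Properties as ℤP
open import Data.List using (List; []; _∷_; _++_; length; filter; map)
open import Data.Nat using (ℕ; zero; suc; _^_; z≤n; s≤s)
import Data.Nat as ℕ
open import Data.Nat.Coprimality using (1-coprimeTo) renaming (sym to coprime-sym)
open import Data.Nat.ListAction using (sum)
import Data.Nat.Properties as ℕP
open import Data.Nat.Tactic.RingSolver using (solve-∀)
open import Data.Product using (Σ; _×_; _,_)
open import Data.Rational as ℚ using (ℚ; mkℚ; 0ℚ; 1ℚ; _≤_; _<_; _+_; _*_; *≤*; *<*)
import Data.Rational.Properties as ℚP
open import Function using (flip)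
open import Relation.Binary.PropositionalEquality
open import Relation.Nullary using (yes; no)
open import Relation.Unary using (Pred; Decidable)

ℕtoℚ≡mkℚ : ∀ n → ℕtoℚ n ≡ mkℚ (+ n) 0 (coprime-sym (1-coprimeTo n))
ℕtoℚ≡mkℚ n = ℚP.normalize-coprime (coprime-sym (1-coprimeTo n))

ℕtoℚ-+ : ∀ m n → ℕtoℚ (m ℕ.+ n) ≡ ℕtoℚ m + ℕtoℚ n
ℕtoℚ-+ m n rewrite ℕtoℚ≡mkℚ m | ℕtoℚ≡mkℚ n | ℕP.*-identityʳ m | ℕP.*-identityʳ n
                 | ℤP.+◃n≡+n m | ℤP.+◃n≡+n n = refl

ℕtoℚ-* : ∀ m n → ℕtoℚ (m ℕ.* n) ≡ ℕtoℚ m * ℕtoℚ n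
ℕtoℚ-* m n rewrite ℕtoℚ≡mkℚ m | ℕtoℚ≡mkℚ n | ℤP.+◃n≡+n (m ℕ.* n) = refl

ℕtoℚ-mono-≤ : ∀ {m n} → m ℕ.≤ n → ℕtoℚ m ≤ ℕtoℚ n
ℕtoℚ-mono-≤ {m} {n} m≤n rewrite ℕtoℚ≡mkℚ m | ℕtoℚ≡mkℚ n =
  *≤* (subst₂ ℤ._≤_ (sym (ℤP.*-identityʳ (+ m))) (sym (ℤP.*-identityʳ (+ n))) (ℤ.+≤+ m≤n))

ℕtoℚ-mono-< : ∀ {m n} → m ℕ.< n → ℕtoℚ m < ℕtoℚ n
ℕtoℚ-mono-< {m} {n} m<n rewrite ℕtoℚ≡mkℚ m | ℕtoℚ≡mkℚ n =
  *<* (subst₂ ℤ._<_ (sym (ℤP.*-identityʳ (+ m))) (sym (ℤP.*-identityʳ (+ n))) (ℤ.+<+ m<n))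

ℕtoℚ-nonNeg : ∀ n → 0ℚ ≤ ℕtoℚ n
ℕtoℚ-nonNeg n = ℕtoℚ-mono-≤ {0} {n} z≤n

*-nonNeg : ∀ {p q} → 0ℚ ≤ p → 0ℚ ≤ q → 0ℚ ≤ p * q
*-nonNeg {p} {q} 0≤p 0≤q =
  ℚP.nonNegative⁻¹ (p * q) {{ℚP.nonNeg*nonNeg⇒nonNeg p {{ℚ.nonNegative 0≤p}} q {{ℚ.nonNegative 0≤q}}}}

*-mono-≤-nonNeg : ∀ {p q r s} → 0ℚ ≤ p → p ≤ q → 0ℚ ≤ r → r ≤ s → p * r ≤ q * s
*-mono-≤-nonNeg {p} {q} {r} {s} 0≤p p≤q 0≤r r≤s =
  ℚP.≤-trans (ℚP.*-monoʳ-≤-nonNeg r {{ℚ.nonNegative 0≤r}} p≤q)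
             (ℚP.*-monoˡ-≤-nonNeg q {{ℚ.nonNegative (ℚP.≤-trans 0≤p p≤q)}} r≤s)

powℚ-nonNeg : ∀ {p} n → 0ℚ ≤ p → 0ℚ ≤ powℚ p n
powℚ-nonNeg zero 0≤p = ℕtoℚ-nonNeg 1
powℚ-nonNeg (suc n) 0≤p = *-nonNeg 0≤p (powℚ-nonNeg n 0≤p)

powℚ-mono-≤ : ∀ {p q} n → 0ℚ ≤ p → p ≤ q → powℚ p n ≤ powℚ q n
powℚ-mono-≤ zero 0≤p p≤q = ℚP.≤-refl
powℚ-mono-≤ (suc n) 0≤p p≤q = *-mono-≤-nonNeg 0≤p p≤q (powℚ-nonNeg n 0≤p) (powℚ-mono-≤ n 0≤p p≤q)

powℚ-cancel-< : ∀ {p q} n → 0ℚ ≤ q → powℚ p n < powℚ q n → p < q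
powℚ-cancel-< n 0≤q pⁿ<qⁿ =
  ℚP.≰⇒> λ q≤p → ℚP.<-irrefl refl (ℚP.<-≤-trans pⁿ<qⁿ (powℚ-mono-≤ n 0≤q q≤p))

powℚ-distrib-* : ∀ p q n → powℚ (p * q) n ≡ powℚ p n * powℚ q n
powℚ-distrib-* p q zero = sym (ℚP.*-identityˡ 1ℚ)
powℚ-distrib-* p q (suc n) = trans (cong ((p * q) *_) (powℚ-distrib-* p q n)) (interchange p q _ _)
  where open CommSemigroupProperties (CommutativeMonoid.commutativeSemigroup ℚP.*-1-commutativeMonoid)

ℕtoℚ-^ : ∀ m n → powℚ (ℕtoℚ m) n ≡ ℕtoℚ (m ^ n)
ℕtoℚ-^ m zero = refl
ℕtoℚ-^ m (suc n) = trans (cong (ℕtoℚ m *_) (ℕtoℚ-^ m n)) (sym (ℕtoℚ-* m (m ^ n)))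

^-distribʳ-* : ∀ m n o → (m ℕ.* n) ^ o ≡ m ^ o ℕ.* n ^ o
^-distribʳ-* m n zero = refl
^-distribʳ-* m n (suc o) = trans (cong ((m ℕ.* n) ℕ.*_) (^-distribʳ-* m n o)) (interchange m n _ _)
  where open CommSemigroupProperties ℕP.*-commutativeSemigroup

markov : ∀ {a p} {A : Set a} {P : Pred A p} (P? : Decidable P) (f : A → ℕ) K {δ} → 0ℚ ≤ δ →
         (∀ x → P x → ℕtoℚ K ≤ δ * ℕtoℚ (f x)) → ∀ L →
         ℕtoℚ (length (filter P? L) ℕ.* K) ≤ δ * ℕtoℚ (sum (map f L))
markov P? f K {δ} 0≤δ K≤δf [] = ℚP.≤-reflexive (sym (ℚP.*-zeroʳ δ))
markov P? f K {δ} 0≤δ K≤δf (x ∷ L) with P? x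
... | yes Px = begin
  ℕtoℚ (K ℕ.+ length (filter P? L) ℕ.* K)          ≡⟨ ℕtoℚ-+ K _ ⟩
  ℕtoℚ K + ℕtoℚ (length (filter P? L) ℕ.* K)      ≤⟨ ℚP.+-mono-≤ (K≤δf x Px) (markov P? f K 0≤δ K≤δf L) ⟩
  δ * ℕtoℚ (f x) + δ * ℕtoℚ (sum (map f L))       ≡⟨ ℚP.*-distribˡ-+ δ _ _ ⟨
  δ * (ℕtoℚ (f x) + ℕtoℚ (sum (map f L)))         ≡⟨ cong (δ *_) (ℕtoℚ-+ (f x) _) ⟨
  δ * ℕtoℚ (f x ℕ.+ sum (map f L))                ∎
  where open ℚP.≤-Reasoning
... | no _ = ℚP.≤-trans (markov P? f K 0≤δ K≤δf L)
               (ℚP.*-monoˡ-≤-nonNeg δ {{ℚ.nonNegative 0≤δ}} (ℕtoℚ-mono-≤ (ℕP.m≤n+m _ (f x))))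

Bad⇒2^N*A<δ*B : ∀ {δ} C M N A B .{{_ : ℕ.NonZero A}} → 0ℚ ≤ δ →
                2 ^ M ℕ.* A ^ C ℕ.≤ B ^ C → Bad C δ M N → ℕtoℚ (2 ^ N ℕ.* A) < δ * ℕtoℚ B
Bad⇒2^N*A<δ*B {δ} C M N A B 0≤δ 2^M*Aᶜ≤Bᶜ bad =
  powℚ-cancel-< C (*-nonNeg 0≤δ (ℕtoℚ-nonNeg B)) (begin-strict
    powℚ (ℕtoℚ (2 ^ N ℕ.* A)) C                 ≡⟨ ℕtoℚ-^ (2 ^ N ℕ.* A) C ⟩
    ℕtoℚ ((2 ^ N ℕ.* A) ^ C)                    ≡⟨ cong ℕtoℚ (^-distribʳ-* (2 ^ N) A C) ⟩
    ℕtoℚ ((2 ^ N) ^ C ℕ.* A ^ C)                ≡⟨ cong (λ k → ℕtoℚ (k ℕ.* A ^ C)) 2^Nᶜ≡2^CN ⟩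
    ℕtoℚ (2 ^ (C ℕ.* N) ℕ.* A ^ C)              ≡⟨ ℕtoℚ-* (2 ^ (C ℕ.* N)) (A ^ C) ⟩
    ℕtoℚ (2 ^ (C ℕ.* N)) * ℕtoℚ (A ^ C)        <⟨ ℚP.*-monoˡ-<-pos (ℕtoℚ (A ^ C)) {{Aᶜ>0}} bad ⟩
    powℚ δ C * ℕtoℚ (2 ^ M) * ℕtoℚ (A ^ C)      ≡⟨ ℚP.*-assoc (powℚ δ C) _ _ ⟩
    powℚ δ C * (ℕtoℚ (2 ^ M) * ℕtoℚ (A ^ C))    ≡⟨ cong (powℚ δ C *_) (ℕtoℚ-* (2 ^ M) (A ^ C)) ⟨
    powℚ δ C * ℕtoℚ (2 ^ M ℕ.* A ^ C)           ≤⟨ ℚP.*-monoˡ-≤-nonNeg (powℚ δ C) {{ℚ.nonNegative (powℚ-nonNeg C 0≤δ)}}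
                                                     (ℕtoℚ-mono-≤ 2^M*Aᶜ≤Bᶜ) ⟩
    powℚ δ C * ℕtoℚ (B ^ C)                     ≡⟨ cong (powℚ δ C *_) (ℕtoℚ-^ B C) ⟨
    powℚ δ C * powℚ (ℕtoℚ B) C                  ≡⟨ powℚ-distrib-* δ (ℕtoℚ B) C ⟨
    powℚ (δ * ℕtoℚ B) C                         ∎)
  where
  open ℚP.≤-Reasoning
  2^Nᶜ≡2^CN : (2 ^ N) ^ C ≡ 2 ^ (C ℕ.* N)
  2^Nᶜ≡2^CN = trans (ℕP.^-*-assoc 2 N C) (cong (2 ^_) (ℕP.*-comm N C))
  Aᶜ>0 : ℚ.Positive (ℕtoℚ (A ^ C))
  Aᶜ>0 = ℚ.positive (ℕtoℚ-mono-< (ℕP.m^n>0 A C))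

-- (16/15)^22 ≥ 4 is what fixes the constant C = 22.
4*15^22≤16^22 : 4 ℕ.* 15 ^ 22 ℕ.≤ 16 ^ 22
4*15^22≤16^22 = ℕP.m≤m+n (4 ℕ.* 15 ^ 22) 10211904114176489623218556

2^M*[15^h]^22≤[16^h]^22 : ∀ M h → M ℕ.≤ 2 ℕ.* h → 2 ^ M ℕ.* (15 ^ h) ^ 22 ℕ.≤ (16 ^ h) ^ 22
2^M*[15^h]^22≤[16^h]^22 M h M≤2h = begin
  2 ^ M ℕ.* (15 ^ h) ^ 22          ≤⟨ ℕP.*-monoˡ-≤ ((15 ^ h) ^ 22) (ℕP.^-monoʳ-≤ 2 M≤2h) ⟩
  2 ^ (2 ℕ.* h) ℕ.* (15 ^ h) ^ 22  ≡⟨ cong₂ ℕ._*_ (ℕP.^-*-assoc 2 2 h) (^-comm 15) ⟨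
  4 ^ h ℕ.* (15 ^ 22) ^ h          ≡⟨ ^-distribʳ-* 4 (15 ^ 22) h ⟨
  (4 ℕ.* 15 ^ 22) ^ h              ≤⟨ ℕP.^-monoˡ-≤ h 4*15^22≤16^22 ⟩
  (16 ^ 22) ^ h                    ≡⟨ ^-comm 16 ⟩
  (16 ^ h) ^ 22                    ∎
  where
  open ℕP.≤-Reasoning
  ^-comm : ∀ b → (b ^ 22) ^ h ≡ (b ^ h) ^ 22
  ^-comm b = trans (ℕP.^-*-assoc b 22 h) (trans (cong (b ^_) (ℕP.*-comm 22 h)) (sym (ℕP.^-*-assoc b h 22)))

4^n*A≤2^N*A*[G*2^n] : ∀ n N A G → 2 ^ n ℕ.≤ G ℕ.* 2 ^ N →
                      4 ^ n ℕ.* A ℕ.≤ 2 ^ N ℕ.* A ℕ.* (G ℕ.* 2 ^ n)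
4^n*A≤2^N*A*[G*2^n] n N A G 2^n≤G*2^N = begin
  4 ^ n ℕ.* A                     ≡⟨ cong (ℕ._* A) (^-distribʳ-* 2 2 n) ⟩
  2 ^ n ℕ.* 2 ^ n ℕ.* A           ≤⟨ ℕP.*-monoˡ-≤ A (ℕP.*-monoˡ-≤ (2 ^ n) 2^n≤G*2^N) ⟩
  G ℕ.* 2 ^ N ℕ.* 2 ^ n ℕ.* A     ≡⟨ shuffle G (2 ^ N) (2 ^ n) A ⟩
  2 ^ N ℕ.* A ℕ.* (G ℕ.* 2 ^ n)   ∎
  where
  open ℕP.≤-Reasoning
  shuffle : ∀ g a b e → g ℕ.* a ℕ.* b ℕ.* e ≡ a ℕ.* e ℕ.* (g ℕ.* b)
  shuffle = solve-∀

module _ {d : ℕ} (T : List (Fin d)) {δ : ℚ} (0≤δ : 0ℚ ≤ δ) where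
  private
    n = length T
    h = weight T []
    K = 4 ^ n ℕ.* 15 ^ h
    c = 16 ^ h ℕ.* 2 ^ n

  Bad⇒K≤δ*c*freshWeight : ∀ a → Bad 22 δ (repeated T) (repeated (selectS T a)) →
                           ℕtoℚ K ≤ δ * ℕtoℚ (c ℕ.* freshWeight T [] a)
  Bad⇒K≤δ*c*freshWeight a bad = begin
    ℕtoℚ K                                    ≤⟨ ℕtoℚ-mono-≤ (4^n*A≤2^N*A*[G*2^n] n N (15 ^ h) G 2^n≤G*2^N) ⟩
    ℕtoℚ (2 ^ N ℕ.* 15 ^ h ℕ.* (G ℕ.* 2 ^ n)) ≡⟨ ℕtoℚ-* (2 ^ N ℕ.* 15 ^ h) (G ℕ.* 2 ^ n) ⟩
    ℕtoℚ (2 ^ N ℕ.* 15 ^ h) * ℕtoℚ (G ℕ.* 2 ^ n)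
      ≤⟨ ℚP.*-monoʳ-≤-nonNeg (ℕtoℚ (G ℕ.* 2 ^ n)) {{ℚ.nonNegative (ℕtoℚ-nonNeg (G ℕ.* 2 ^ n))}}
           (ℚP.<⇒≤ (Bad⇒2^N*A<δ*B 22 (repeated T) N (15 ^ h) (16 ^ h) {{ℕP.m^n≢0 15 h}} 0≤δ
                      (2^M*[15^h]^22≤[16^h]^22 (repeated T) h (repeated≤2*weight T)) bad)) ⟩
    δ * ℕtoℚ (16 ^ h) * ℕtoℚ (G ℕ.* 2 ^ n)     ≡⟨ ℚP.*-assoc δ _ _ ⟩
    δ * (ℕtoℚ (16 ^ h) * ℕtoℚ (G ℕ.* 2 ^ n))   ≡⟨ cong (δ *_) (ℕtoℚ-* (16 ^ h) (G ℕ.* 2 ^ n)) ⟨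
    δ * ℕtoℚ (16 ^ h ℕ.* (G ℕ.* 2 ^ n))        ≡⟨ cong (λ k → δ * ℕtoℚ k) (rearrange (16 ^ h) G (2 ^ n)) ⟩
    δ * ℕtoℚ (c ℕ.* G)                         ∎
    where
    open ℚP.≤-Reasoning
    S = selectS T a
    N = repeated S
    G = freshWeight T [] a
    2^n≤G*2^N : 2 ^ n ℕ.≤ G ℕ.* 2 ^ N
    2^n≤G*2^N = subst (λ r → 2 ^ n ℕ.≤ G ℕ.* 2 ^ r) (sym (length-filter≡repeatedBy (flip occ S) S))
                  (2^length≤freshWeight*2^repeatedBy T [] a)
    rearrange : ∀ x g y → x ℕ.* (g ℕ.* y) ≡ x ℕ.* y ℕ.* g
    rearrange = solve-∀

  badCount≤δ*2^length : ℕtoℚ (badCount 22 δ T) ≤ δ * ℕtoℚ (2 ^ n)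
  badCount≤δ*2^length = ℚP.*-cancelʳ-≤-pos (ℕtoℚ K) {{K>0}} (begin
    ℕtoℚ (badCount 22 δ T) * ℕtoℚ K          ≡⟨ ℕtoℚ-* (badCount 22 δ T) K ⟨
    ℕtoℚ (badCount 22 δ T ℕ.* K)
      ≤⟨ markov _ (λ a → c ℕ.* freshWeight T [] a) K 0≤δ Bad⇒K≤δ*c*freshWeight A ⟩
    δ * ℕtoℚ (sum (map (λ a → c ℕ.* freshWeight T [] a) A))
      ≡⟨ cong (λ k → δ * ℕtoℚ k) (sum-map-*ˡ c (freshWeight T []) A) ⟩
    δ * ℕtoℚ (c ℕ.* totalFreshWeight T [])
      ≤⟨ ℚP.*-monoˡ-≤-nonNeg δ {{ℚ.nonNegative 0≤δ}} (ℕtoℚ-mono-≤ c*total≤2^n*K) ⟩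
    δ * ℕtoℚ (2 ^ n ℕ.* K)                    ≡⟨ cong (δ *_) (ℕtoℚ-* (2 ^ n) K) ⟩
    δ * (ℕtoℚ (2 ^ n) * ℕtoℚ K)               ≡⟨ ℚP.*-assoc δ _ _ ⟨
    δ * ℕtoℚ (2 ^ n) * ℕtoℚ K                 ∎)
    where
    open ℚP.≤-Reasoning
    A = assignments n
    K>0 : ℚ.Positive (ℕtoℚ K)
    K>0 = ℚ.positive (ℕtoℚ-mono-< (ℕP.*-mono-< (ℕP.m^n>0 4 n) (ℕP.m^n>0 15 h)))
    c*total≤2^n*K : c ℕ.* totalFreshWeight T [] ℕ.≤ 2 ^ n ℕ.* K
    c*total≤2^n*K = ℕP.≤-trans (ℕP.≤-reflexive (rearrange (16 ^ h) (2 ^ n) (totalFreshWeight T [])))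
                               (ℕP.*-monoʳ-≤ (2 ^ n) (totalFreshWeight≼ T []))
      where
      rearrange : ∀ a b g → a ℕ.* b ℕ.* g ≡ b ℕ.* (g ℕ.* a)
      rearrange = solve-∀

lemma4p7 : Σ ℕ λ C → (1 Data.Nat.≤ C) ×
    ((d : ℕ) (Tp0 Tp1 Tq0 Tq1 : List (Fin d)) (δ : ℚ) → 0ℚ < δ → δ < 1ℚ →
      ℕtoℚ (badCount C δ (Tp0 ++ Tp1 ++ Tq0 ++ Tq1))
        ≤ δ * ℕtoℚ (2 ^ length (Tp0 ++ Tp1 ++ Tq0 ++ Tq1)))
lemma4p7 = 22 , s≤s z≤n , λ d Tp0 Tp1 Tq0 Tq1 δ 0<δ _ →
  badCount≤δ*2^length (Tp0 ++ Tp1 ++ Tq0 ++ Tq1) (ℚP.<⇒≤ 0<δ)
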